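{- Let $(\widetilde J_3(n))_{n\ge0}$ be defined by $\widetilde J_3(0)=0$, $\widetilde J_3(1)=\frac12$ and $4n^2\widetilde J_3(n)-(8n^2-8n+3)\widetilde J_3(n-1)+4(n-1)^2\widetilde J_3(n-2)=\frac{2^n(n-1)!}{(2n-1)!!}$ for $n\ge2$, and let $\widetilde g_3(x)=\sum_{n=0}^\infty\binom{ -\frac12}{n}\widetilde J_3(n)x^n$. Then, for $x$ in a neighborhood of $0$, $$\widetilde g_3(x)=\frac{ -2}{\sqrt{1+x}}\sum_{k=1}^\infty(-1)^k\binom{ -\frac12}{k}^{3}\left(\frac{x}{1+x}\right)^{k}\sum_{j=0}^{k-1}\frac{1}{(2j+1)^3}\binom{ -\frac12}{j}^{ -2}.$$
   Context: $\binom{ -1/2}{k}$ is the generalized binomial coefficient $\frac{(-1/2)(-3/2)\cdots(-1/2-k+1)}{k!}$ and $(2n-1)!!=1\cdot3\cdots(2n-1)$. -}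

module Defs where

open import Data.Nat as ℕ using (ℕ; zero; suc; _∸_)
import Data.Nat.Properties as ℕP

open import Data.Integer as ℤ using (ℤ; +_)
open import Data.Rational using (ℚ; 0ℚ; 1ℚ; _+_; _*_; -_; _/_; 1/_; _≟_; ≢-nonZero)
open import Relation.Nullary using (yes; no)

_^ℚ_ : ℚ → ℕ → ℚ
p ^ℚ zero = 1ℚ
p ^ℚ suc k = p * (p ^ℚ k)

-- total inverse: 1/p for p ≠ 0 (value at 0 is irrelevant: only applied to nonzero numbers)
inv : ℚ → ℚ
inv p with p ≟ 0ℚ
... | yes _ = 0ℚ
... | no p≢0 = 1/_ p {{≢-nonZero p≢0}}

Σ< : ℕ → (ℕ → ℚ) → ℚ
Σ< zero f = 0ℚ
Σ< (suc n) f = Σ< n f + f n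

ℕ→ℚ : ℕ → ℚ
ℕ→ℚ n = + n / 1

gbinom : ℚ → ℕ → ℚ
gbinom a zero = 1ℚ
gbinom a (suc k) = gbinom a k * ((a + - ℕ→ℚ k) * (+ 1 / suc k))

bh : ℕ → ℚ
bh = gbinom (- (+ 1 / 2))

-- odd double factorial (2n-1)!! = 1·3···(2n-1), with (-1)!! = 1
oddDF : ℕ → ℕ
oddDF zero = 1
oddDF (suc n) = oddDF n ℕ.* (suc (2 ℕ.* n))

oddDF-nz : ∀ n → ℕ.NonZero (oddDF n)
oddDF-nz zero = _
oddDF-nz (suc n) = ℕP.m*n≢0 (oddDF n) (suc (2 ℕ.* n)) {{oddDF-nz n}}

recRHS : ℕ → ℚ
recRHS n = _/_ (+ (2 ℕ.^ n ℕ.* ((n ∸ 1) ℕ.!))) (oddDF n) {{oddDF-nz n}}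

-- Formal power series over ℚ, as coefficient sequences

Series : Set
Series = ℕ → ℚ

_⊛_ : Series → Series → Series
(f ⊛ g) n = Σ< (suc n) (λ i → f i * g (n ∸ i))

scale : ℚ → Series → Series
scale c f n = c * f n

_^S_ : Series → ℕ → Series
f ^S zero = λ { zero → 1ℚ ; (suc _) → 0ℚ }
f ^S suc k = f ⊛ (f ^S k)

-- 1/sqrt(1+x) = Σ binom(-1/2,n) x^n (binomial series)
invSqrt1px : Series
invSqrt1px = bh

-- x/(1+x) = Σ_{n≥1} (-1)^(n-1) x^n
xOver1px : Series
xOver1px zero = 0ℚ
xOver1px (suc n) = (- 1ℚ) ^ℚ n

-- Σ_{k≥1} c k · S^k for a series S with zero constant term:
-- only k ≤ n contribute to the coefficient of x^n.
compose≥1 : (ℕ → ℚ) → Series → Series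
compose≥1 c S n = Σ< n (λ i → c (suc i) * (S ^S suc i) n)

cCoeff : ℕ → ℚ
cCoeff k = ((- 1ℚ) ^ℚ k) * (bh k ^ℚ 3)
           * Σ< k (λ j → inv (ℕ→ℚ (suc (2 ℕ.* j)) ^ℚ 3) * inv (bh j ^ℚ 2))

rhsSeries : Series
rhsSeries = scale (- (+ 2 / 1)) (invSqrt1px ⊛ compose≥1 cCoeff xOver1px)

g̃₃ : (ℕ → ℚ) → Series
g̃₃ J n = bh n * J n

{-# OPTIONS --safe #-}
-- J is the binomial transform  J n = Σₖ C(n,k) φ k  of  φ k = -2 (-1)ᵏ C(-1/2,k)² Hₖ,  Hₖ the
-- inner sum.  The binomial transform turns multiplication by k into θ u n = n (u n - u (n-1)),
-- hence the operator of the recurrence into  φ ↦ 4(k+1)² φ(k+1) + (2k+1)² φ k;  since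
-- 2(k+1) C(-1/2,k+1) = -(2k+1) C(-1/2,k), this maps φ to 2(-1)ᵏ/(2k+1), whose binomial transform
-- is 2ⁿ⁺¹ n!/(2n+1)!!.  So Σₖ C(n,k) φ k solves the recurrence with the initial values of J.
-- On the series side, (1+x)ᵃ (x/(1+x))ᵏ = xᵏ (1+x)ᵃ⁻ᵏ has n-th coefficient C(a,n) C(n,k) / C(a,k),
-- so the n-th coefficient of the right-hand side is C(-1/2,n) Σₖ C(n,k) φ k.

module Submission where

open import Defs
open import Data.Nat using (ℕ; _≥_; _∸_)
open import Data.Integer using (+_)
open import Data.Rational using (ℚ; 0ℚ; _+_; _-_; _*_; _/_)
open import Relation.Binary.PropositionalEquality using (_≡_)

open import Data.Maybe.Base using (Maybe; just; nothing)
open import Data.Nat as ℕ using (zero; suc; _≤_; _<_; z≤n; s≤s; NonZero)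
import Data.Nat.Properties as ℕ
open import Data.Nat.Coprimality using (1-coprimeTo)
import Data.Nat.Coprimality as Coprime
open import Data.Nat.Tactic.RingSolver using () renaming (solve-∀ to ℕ-solve-∀)
import Data.Integer as ℤ
import Data.Integer.Properties as ℤ
open import Data.Rational using (mkℚ; 1ℚ; -_; _≟_; ≢-nonZero; 1/_)
import Data.Rational.Properties as ℚ
import Data.Rational.Unnormalised as ℚᵘ
import Data.Rational.Unnormalised.Properties as ℚᵘ
open import Data.Product using (_×_; _,_; proj₁)
open import Data.Sum using (inj₁; inj₂)
open import Function using (_∘_)
open import Level using (0ℓ)
open import Relation.Nullary using (yes; no; contradiction)
open import Relation.Binary.PropositionalEquality
  using (refl; sym; trans; cong; cong₂; _≢_; module ≡-Reasoning)
open import Algebra.Properties.Group ℚ.+-0-group using (∙-cancelʳ)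
open import Tactic.RingSolver using (solve-∀)
open import Tactic.RingSolver.Core.AlmostCommutativeRing
  using (AlmostCommutativeRing; fromCommutativeRing)

open ≡-Reasoning

ring : AlmostCommutativeRing 0ℓ 0ℓ
ring = fromCommutativeRing ℚ.+-*-commutativeRing isZero
  where
  isZero : ∀ x → Maybe (0ℚ ≡ x)
  isZero x with 0ℚ ≟ x
  ... | yes 0≡x = just 0≡x
  ... | no _    = nothing

*-cancelˡ-≢0 : ∀ {c x y} → c ≢ 0ℚ → c * x ≡ c * y → x ≡ y
*-cancelˡ-≢0 {c} {x} {y} c≢0 cx≡cy = begin
  x                 ≡⟨ unit x ⟨
  (1/ c * c) * x    ≡⟨ ℚ.*-assoc (1/ c) c x ⟩
  1/ c * (c * x)    ≡⟨ cong (1/ c *_) cx≡cy ⟩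
  1/ c * (c * y)    ≡⟨ ℚ.*-assoc (1/ c) c y ⟨
  (1/ c * c) * y    ≡⟨ unit y ⟩
  y                 ∎
  where
  instance _ = ≢-nonZero c≢0
  unit : ∀ z → (1/ c * c) * z ≡ z
  unit z = trans (cong (_* z) (ℚ.*-inverseˡ c)) (ℚ.*-identityˡ z)

*-≢0 : ∀ {p q} → p ≢ 0ℚ → q ≢ 0ℚ → p * q ≢ 0ℚ
*-≢0 {p} {q} p≢0 q≢0 pq≡0 = q≢0 (*-cancelˡ-≢0 p≢0 (trans pq≡0 (sym (ℚ.*-zeroʳ p))))

^ℚ-≢0 : ∀ {p} n → p ≢ 0ℚ → p ^ℚ n ≢ 0ℚ
^ℚ-≢0 zero    p≢0 ()
^ℚ-≢0 (suc n) p≢0 = *-≢0 p≢0 (^ℚ-≢0 n p≢0)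

inv-inverseˡ : ∀ {p} → p ≢ 0ℚ → inv p * p ≡ 1ℚ
inv-inverseˡ {p} p≢0 with p ≟ 0ℚ
... | yes p≡0 = contradiction p≡0 p≢0
... | no p≢0′ = ℚ.*-inverseˡ p {{≢-nonZero p≢0′}}

*-inv-cancel : ∀ {p q} → p ≢ 0ℚ → q ≢ 0ℚ → (p * q) * (inv p * inv q) ≡ 1ℚ
*-inv-cancel {p} {q} p≢0 q≢0 = begin
  (p * q) * (inv p * inv q)   ≡⟨ regroup p q (inv p) (inv q) ⟩
  (inv p * p) * (inv q * q)   ≡⟨ cong₂ _*_ (inv-inverseˡ p≢0) (inv-inverseˡ q≢0) ⟩
  1ℚ * 1ℚ                     ≡⟨ ℚ.*-identityˡ 1ℚ ⟩
  1ℚ                          ∎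
  where
  regroup : ∀ p q p′ q′ → (p * q) * (p′ * q′) ≡ (p′ * p) * (q′ * q)
  regroup = solve-∀ ring

x+y≡z⇒x≡z-y : ∀ {x y z} → x + y ≡ z → x ≡ z - y
x+y≡z⇒x≡z-y {x} {y} refl = cancel x y
  where
  cancel : ∀ x y → x ≡ x + y - y
  cancel = solve-∀ ring

ℕ→ℚ≡mkℚ : ∀ n → ℕ→ℚ n ≡ mkℚ (+ n) 0 (Coprime.sym (1-coprimeTo n))
ℕ→ℚ≡mkℚ n = ℚ.↥p/↧p≡p (mkℚ (+ n) 0 (Coprime.sym (1-coprimeTo n)))

ℕ→ℚ-+ : ∀ m n → ℕ→ℚ (m ℕ.+ n) ≡ ℕ→ℚ m + ℕ→ℚ n
ℕ→ℚ-+ m n = sym (begin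
  ℕ→ℚ m + ℕ→ℚ n
    ≡⟨ cong₂ _+_ (ℕ→ℚ≡mkℚ m) (ℕ→ℚ≡mkℚ n) ⟩
  (+ m ℤ.* + 1 ℤ.+ + n ℤ.* + 1) / 1
    ≡⟨ ℚ./-cong (trans (cong₂ ℤ._+_ (ℤ.*-identityʳ (+ m)) (ℤ.*-identityʳ (+ n)))
                       (sym (ℤ.pos-+ m n))) refl ⟩
  ℕ→ℚ (m ℕ.+ n) ∎)

ℕ→ℚ-suc : ∀ n → ℕ→ℚ (suc n) ≡ 1ℚ + ℕ→ℚ n
ℕ→ℚ-suc = ℕ→ℚ-+ 1

ℕ→ℚ-* : ∀ m n → ℕ→ℚ (m ℕ.* n) ≡ ℕ→ℚ m * ℕ→ℚ n
ℕ→ℚ-* m n = sym (begin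
  ℕ→ℚ m * ℕ→ℚ n             ≡⟨ cong₂ _*_ (ℕ→ℚ≡mkℚ m) (ℕ→ℚ≡mkℚ n) ⟩
  (+ m ℤ.* + n) / 1          ≡⟨ ℚ./-cong (sym (ℤ.pos-* m n)) refl ⟩
  ℕ→ℚ (m ℕ.* n)             ∎)

ℕ→ℚ-odd : ∀ k → ℕ→ℚ (suc (2 ℕ.* k)) ≡ ℕ→ℚ 2 * ℕ→ℚ k + 1ℚ
ℕ→ℚ-odd k = begin
  ℕ→ℚ (suc (2 ℕ.* k))       ≡⟨ ℕ→ℚ-suc (2 ℕ.* k) ⟩
  1ℚ + ℕ→ℚ (2 ℕ.* k)        ≡⟨ cong (λ x → 1ℚ + x) (ℕ→ℚ-* 2 k) ⟩
  1ℚ + ℕ→ℚ 2 * ℕ→ℚ k        ≡⟨ ℚ.+-comm 1ℚ (ℕ→ℚ 2 * ℕ→ℚ k) ⟩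
  ℕ→ℚ 2 * ℕ→ℚ k + 1ℚ        ∎

ℕ→ℚ-≢0 : ∀ n .{{_ : NonZero n}} → ℕ→ℚ n ≢ 0ℚ
ℕ→ℚ-≢0 (suc n) eq with trans (sym (ℕ→ℚ≡mkℚ (suc n))) eq
... | ()

/-*-cancel : ∀ a d .{{_ : NonZero d}} → (+ a / d) * ℕ→ℚ d ≡ ℕ→ℚ a
/-*-cancel a d@(suc d-1) = ℚ.toℚᵘ-injective
  (ℚᵘ.≃-trans (ℚ.toℚᵘ-homo-* (+ a / d) (ℕ→ℚ d))
  (ℚᵘ.≃-trans (ℚᵘ.*-cong (ℚ.toℚᵘ-fromℚᵘ (ℚᵘ.mkℚᵘ (+ a) d-1)) (ℚ.toℚᵘ-fromℚᵘ (ℚᵘ.mkℚᵘ (+ d) 0)))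
  (ℚᵘ.≃-trans (ℚᵘ.*≡* cross-multiplied) (ℚᵘ.≃-sym (ℚ.toℚᵘ-fromℚᵘ (ℚᵘ.mkℚᵘ (+ a) 0))))))
  where
  cross-multiplied : (+ a ℤ.* + d) ℤ.* + 1 ≡ + a ℤ.* + suc (d-1 ℕ.* 1)
  cross-multiplied =
    trans (ℤ.*-identityʳ _) (cong (λ m → + a ℤ.* + suc m) (sym (ℕ.*-identityʳ d-1)))

Σ<-cong-< : ∀ n {f g : ℕ → ℚ} → (∀ i → i < n → f i ≡ g i) → Σ< n f ≡ Σ< n g
Σ<-cong-< zero    f≡g = refl
Σ<-cong-< (suc n) f≡g =
  cong₂ _+_ (Σ<-cong-< n (λ i i<n → f≡g i (ℕ.m<n⇒m<1+n i<n))) (f≡g n (ℕ.n<1+n n))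

Σ<-cong : ∀ n {f g : ℕ → ℚ} → (∀ i → f i ≡ g i) → Σ< n f ≡ Σ< n g
Σ<-cong n f≡g = Σ<-cong-< n (λ i _ → f≡g i)

Σ<-distrib-+ : ∀ n (f g : ℕ → ℚ) → Σ< n (λ i → f i + g i) ≡ Σ< n f + Σ< n g
Σ<-distrib-+ zero    f g = sym (ℚ.+-identityˡ 0ℚ)
Σ<-distrib-+ (suc n) f g = begin
  Σ< n (λ i → f i + g i) + (f n + g n)  ≡⟨ cong (_+ (f n + g n)) (Σ<-distrib-+ n f g) ⟩
  (Σ< n f + Σ< n g) + (f n + g n)       ≡⟨ interchange (Σ< n f) (Σ< n g) (f n) (g n) ⟩
  (Σ< n f + f n) + (Σ< n g + g n)       ∎
  where
  interchange : ∀ a b c d → (a + b) + (c + d) ≡ (a + c) + (b + d)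
  interchange = solve-∀ ring

*-distribˡ-Σ< : ∀ n c (f : ℕ → ℚ) → c * Σ< n f ≡ Σ< n (λ i → c * f i)
*-distribˡ-Σ< zero    c f = ℚ.*-zeroʳ c
*-distribˡ-Σ< (suc n) c f =
  trans (ℚ.*-distribˡ-+ c (Σ< n f) (f n)) (cong (_+ c * f n) (*-distribˡ-Σ< n c f))

Σ<-sucˡ : ∀ n (f : ℕ → ℚ) → Σ< (suc n) f ≡ f 0 + Σ< n (f ∘ suc)
Σ<-sucˡ zero    f = trans (ℚ.+-identityˡ (f 0)) (sym (ℚ.+-identityʳ (f 0)))
Σ<-sucˡ (suc n) f = trans (cong (_+ f (suc n)) (Σ<-sucˡ n f)) (ℚ.+-assoc (f 0) _ _)

Σ<-vanish : ∀ n {f : ℕ → ℚ} → (∀ i → i < n → f i ≡ 0ℚ) → Σ< n f ≡ 0ℚ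
Σ<-vanish zero    f≡0 = refl
Σ<-vanish (suc n) f≡0 = trans
  (cong₂ _+_ (Σ<-vanish n (λ i i<n → f≡0 i (ℕ.m<n⇒m<1+n i<n))) (f≡0 n (ℕ.n<1+n n)))
  (ℚ.+-identityˡ 0ℚ)

Σ<-extend : ∀ {m} n {f : ℕ → ℚ} → m ≤ n → (∀ i → m ≤ i → f i ≡ 0ℚ) → Σ< n f ≡ Σ< m f
Σ<-extend zero    z≤n f≡0 = refl
Σ<-extend (suc n) m≤1+n f≡0 with ℕ.m≤n⇒m<n∨m≡n m≤1+n
... | inj₂ refl      = refl
... | inj₁ (s≤s m≤n) = trans (cong₂ _+_ (Σ<-extend n m≤n f≡0) (f≡0 n m≤n)) (ℚ.+-identityʳ _)

Σ<-comm : ∀ m n (f : ℕ → ℕ → ℚ) →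
          Σ< m (λ i → Σ< n (f i)) ≡ Σ< n (λ j → Σ< m (λ i → f i j))
Σ<-comm zero    n f = sym (Σ<-vanish n (λ _ _ → refl))
Σ<-comm (suc m) n f = trans (cong (_+ Σ< n (f m)) (Σ<-comm m n f))
                            (sym (Σ<-distrib-+ n (λ j → Σ< m (λ i → f i j)) (f m)))

binom : ℕ → ℕ → ℚ
binom n       zero    = 1ℚ
binom zero    (suc k) = 0ℚ
binom (suc n) (suc k) = binom n k + binom n (suc k)

binom-vanish : ∀ {n k} → n < k → binom n k ≡ 0ℚ
binom-vanish {zero}  {suc k} _         = refl
binom-vanish {suc n} {suc k} (s≤s n<k) =
  trans (cong₂ _+_ (binom-vanish n<k) (binom-vanish (ℕ.m<n⇒m<1+n n<k))) (ℚ.+-identityˡ 0ℚ)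

binom-sucʳ : ∀ n k → ℕ→ℚ (suc k) * binom n (suc k) ≡ (ℕ→ℚ n - ℕ→ℚ k) * binom n k
binom-sucʳ zero    zero    = refl
binom-sucʳ zero    (suc k) =
  trans (ℚ.*-zeroʳ (ℕ→ℚ (suc (suc k)))) (sym (ℚ.*-zeroʳ (0ℚ - ℕ→ℚ (suc k))))
binom-sucʳ (suc n) zero
  with ih ← binom-sucʳ n zero rewrite ℕ→ℚ-suc n = begin
  ℕ→ℚ 1 * (1ℚ + binom n 1)        ≡⟨ regroup (binom n 1) ⟩
  1ℚ + ℕ→ℚ 1 * binom n 1          ≡⟨ cong (_+_ 1ℚ) ih ⟩
  1ℚ + (ℕ→ℚ n - 0ℚ) * 1ℚ          ≡⟨ simplify (ℕ→ℚ n) ⟩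
  (1ℚ + ℕ→ℚ n - 0ℚ) * 1ℚ          ∎
  where
  regroup : ∀ b → ℕ→ℚ 1 * (1ℚ + b) ≡ 1ℚ + ℕ→ℚ 1 * b
  regroup = solve-∀ ring
  simplify : ∀ x → 1ℚ + (x - 0ℚ) * 1ℚ ≡ (1ℚ + x - 0ℚ) * 1ℚ
  simplify = solve-∀ ring
binom-sucʳ (suc n) (suc k)
  with ih₁ ← binom-sucʳ n (suc k) | ih₀ ← binom-sucʳ n k
  rewrite ℕ→ℚ-suc (suc k) | ℕ→ℚ-suc k | ℕ→ℚ-suc n = begin
  (1ℚ + (1ℚ + y)) * (B₁ + B₂)                  ≡⟨ ℚ.*-distribˡ-+ (1ℚ + (1ℚ + y)) B₁ B₂ ⟩
  (1ℚ + (1ℚ + y)) * B₁ + (1ℚ + (1ℚ + y)) * B₂  ≡⟨ cong (λ t → (1ℚ + (1ℚ + y)) * B₁ + t) ih₁ ⟩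
  (1ℚ + (1ℚ + y)) * B₁ + (x - (1ℚ + y)) * B₁   ≡⟨ regroup x y B₁ ⟩
  (x - y) * B₁ + (1ℚ + y) * B₁                 ≡⟨ cong (λ t → (x - y) * B₁ + t) ih₀ ⟩
  (x - y) * B₁ + (x - y) * B₀                  ≡⟨ factor x y B₀ B₁ ⟩
  (1ℚ + x - (1ℚ + y)) * (B₀ + B₁)              ∎
  where
  x = ℕ→ℚ n
  y = ℕ→ℚ k
  B₀ = binom n k
  B₁ = binom n (suc k)
  B₂ = binom n (suc (suc k))
  regroup : ∀ x y B → (1ℚ + (1ℚ + y)) * B + (x - (1ℚ + y)) * B ≡ (x - y) * B + (1ℚ + y) * B
  regroup = solve-∀ ring
  factor : ∀ x y B₀ B₁ → (x - y) * B₁ + (x - y) * B₀ ≡ (1ℚ + x - (1ℚ + y)) * (B₀ + B₁)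
  factor = solve-∀ ring

binom-absorption : ∀ n k → ℕ→ℚ (suc k) * binom (suc n) (suc k) ≡ ℕ→ℚ (suc n) * binom n k
binom-absorption n k with ratio ← binom-sucʳ n k rewrite ℕ→ℚ-suc k | ℕ→ℚ-suc n = begin
  (1ℚ + y) * (B₀ + B₁)            ≡⟨ ℚ.*-distribˡ-+ (1ℚ + y) B₀ B₁ ⟩
  (1ℚ + y) * B₀ + (1ℚ + y) * B₁   ≡⟨ cong (λ t → (1ℚ + y) * B₀ + t) ratio ⟩
  (1ℚ + y) * B₀ + (x - y) * B₀    ≡⟨ collect x y B₀ ⟩
  (1ℚ + x) * B₀                   ∎
  where
  x = ℕ→ℚ n
  y = ℕ→ℚ k
  B₀ = binom n k
  B₁ = binom n (suc k)
  collect : ∀ x y B → (1ℚ + y) * B + (x - y) * B ≡ (1ℚ + x) * B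
  collect = solve-∀ ring

binomialTransform : (ℕ → ℚ) → ℕ → ℚ
binomialTransform g n = Σ< (suc n) (λ k → binom n k * g k)

binomialTransform-cong : ∀ {f g : ℕ → ℚ} n → (∀ k → f k ≡ g k) →
                         binomialTransform f n ≡ binomialTransform g n
binomialTransform-cong {f} {g} n f≡g = Σ<-cong (suc n) (λ k → cong (binom n k *_) (f≡g k))

binomialTransform-+ : ∀ (f g : ℕ → ℚ) n →
  binomialTransform (λ k → f k + g k) n ≡ binomialTransform f n + binomialTransform g n
binomialTransform-+ f g n = trans
  (Σ<-cong (suc n) (λ k → ℚ.*-distribˡ-+ (binom n k) (f k) (g k)))
  (Σ<-distrib-+ (suc n) (λ k → binom n k * f k) (λ k → binom n k * g k))

binomialTransform-* : ∀ c (f : ℕ → ℚ) n →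
  binomialTransform (λ k → c * f k) n ≡ c * binomialTransform f n
binomialTransform-* c f n = trans
  (Σ<-cong (suc n) (λ k → swap (binom n k) c (f k)))
  (sym (*-distribˡ-Σ< (suc n) c (λ k → binom n k * f k)))
  where
  swap : ∀ a c x → a * (c * x) ≡ c * (a * x)
  swap = solve-∀ ring

binomialTransform-suc : ∀ (g : ℕ → ℚ) n →
  binomialTransform g (suc n) ≡ binomialTransform g n + binomialTransform (g ∘ suc) n
binomialTransform-suc g n = begin
  binomialTransform g (suc n)
    ≡⟨ Σ<-sucˡ (suc n) (λ k → binom (suc n) k * g k) ⟩
  1ℚ * g 0 + Σ< (suc n) (λ k → (binom n k + binom n (suc k)) * g (suc k))
    ≡⟨ cong (λ t → 1ℚ * g 0 + t) (trans
         (Σ<-cong (suc n) (λ k → ℚ.*-distribʳ-+ (g (suc k)) (binom n k) (binom n (suc k))))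
         (Σ<-distrib-+ (suc n) (λ k → binom n k * g (suc k)) (λ k → binom n (suc k) * g (suc k)))) ⟩
  1ℚ * g 0 + (binomialTransform (g ∘ suc) n + Σ< (suc n) (λ k → binom n (suc k) * g (suc k)))
    ≡⟨ exchange (1ℚ * g 0) (binomialTransform (g ∘ suc) n) _ ⟩
  (1ℚ * g 0 + Σ< (suc n) (λ k → binom n (suc k) * g (suc k))) + binomialTransform (g ∘ suc) n
    ≡⟨ cong (_+ binomialTransform (g ∘ suc) n) (sym (Σ<-sucˡ (suc n) (λ k → binom n k * g k))) ⟩
  Σ< (suc (suc n)) (λ k → binom n k * g k) + binomialTransform (g ∘ suc) n
    ≡⟨ cong (_+ binomialTransform (g ∘ suc) n) (Σ<-extend (suc (suc n)) (ℕ.n≤1+n (suc n))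
         (λ k n<k → trans (cong (_* g k) (binom-vanish n<k)) (ℚ.*-zeroˡ (g k)))) ⟩
  binomialTransform g n + binomialTransform (g ∘ suc) n ∎
  where
  exchange : ∀ a b c → a + (b + c) ≡ (a + c) + b
  exchange = solve-∀ ring

binomialTransform-absorption : ∀ (g : ℕ → ℚ) n →
  binomialTransform (λ k → ℕ→ℚ k * g k) (suc n) ≡ ℕ→ℚ (suc n) * binomialTransform (g ∘ suc) n
binomialTransform-absorption g n = begin
  binomialTransform (λ k → ℕ→ℚ k * g k) (suc n)
    ≡⟨ Σ<-sucˡ (suc n) _ ⟩
  1ℚ * (0ℚ * g 0) + Σ< (suc n) (λ k → binom (suc n) (suc k) * (ℕ→ℚ (suc k) * g (suc k)))
    ≡⟨ drop-zero (g 0) _ ⟩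
  Σ< (suc n) (λ k → binom (suc n) (suc k) * (ℕ→ℚ (suc k) * g (suc k)))
    ≡⟨ Σ<-cong (suc n) absorb ⟩
  Σ< (suc n) (λ k → ℕ→ℚ (suc n) * (binom n k * g (suc k)))
    ≡⟨ *-distribˡ-Σ< (suc n) (ℕ→ℚ (suc n)) _ ⟨
  ℕ→ℚ (suc n) * binomialTransform (g ∘ suc) n ∎
  where
  drop-zero : ∀ a b → 1ℚ * (0ℚ * a) + b ≡ b
  drop-zero = solve-∀ ring
  reassoc : ∀ c x a → c * (x * a) ≡ (x * c) * a
  reassoc = solve-∀ ring
  absorb : ∀ k → binom (suc n) (suc k) * (ℕ→ℚ (suc k) * g (suc k))
                 ≡ ℕ→ℚ (suc n) * (binom n k * g (suc k))
  absorb k = begin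
    binom (suc n) (suc k) * (ℕ→ℚ (suc k) * g (suc k))
      ≡⟨ reassoc (binom (suc n) (suc k)) (ℕ→ℚ (suc k)) (g (suc k)) ⟩
    (ℕ→ℚ (suc k) * binom (suc n) (suc k)) * g (suc k)
      ≡⟨ cong (_* g (suc k)) (binom-absorption n k) ⟩
    (ℕ→ℚ (suc n) * binom n k) * g (suc k)
      ≡⟨ ℚ.*-assoc (ℕ→ℚ (suc n)) (binom n k) (g (suc k)) ⟩
    ℕ→ℚ (suc n) * (binom n k * g (suc k)) ∎

θ : (ℕ → ℚ) → ℕ → ℚ
θ u n = ℕ→ℚ n * (u n - u (n ∸ 1))

θ-cong : ∀ {u v : ℕ → ℚ} → (∀ n → u n ≡ v n) → ∀ n → θ u n ≡ θ v n
θ-cong u≡v n = cong₂ (λ a b → ℕ→ℚ n * (a - b)) (u≡v n) (u≡v (n ∸ 1))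

binomialTransform-θ : ∀ (g : ℕ → ℚ) n →
  binomialTransform (λ k → ℕ→ℚ k * g k) n ≡ θ (binomialTransform g) n
binomialTransform-θ g zero = vanish (g 0) (binomialTransform g 0 - binomialTransform g 0)
  where
  vanish : ∀ a b → 0ℚ + 1ℚ * (0ℚ * a) ≡ 0ℚ * b
  vanish = solve-∀ ring
binomialTransform-θ g (suc n) = begin
  T (λ k → ℕ→ℚ k * g k) (suc n)  ≡⟨ binomialTransform-absorption g n ⟩
  ℕ→ℚ (suc n) * T (g ∘ suc) n    ≡⟨ cong (ℕ→ℚ (suc n) *_) (x+y≡z⇒x≡z-y pascal) ⟩
  θ (T g) (suc n)                ∎
  where
  T = binomialTransform
  pascal : T (g ∘ suc) n + T g n ≡ T g (suc n)
  pascal = trans (ℚ.+-comm (T (g ∘ suc) n) (T g n)) (sym (binomialTransform-suc g n))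

alternating : ℕ → ℚ
alternating k = (- 1ℚ) ^ℚ k

binomialTransform-alternating : ∀ n → binomialTransform alternating (suc n) ≡ 0ℚ
binomialTransform-alternating n = begin
  T alternating (suc n)                      ≡⟨ binomialTransform-suc alternating n ⟩
  T alternating n + T (alternating ∘ suc) n  ≡⟨ cong (_+_ (T alternating n))
                                                  (binomialTransform-* (- 1ℚ) alternating n) ⟩
  T alternating n + - 1ℚ * T alternating n   ≡⟨ cancel (T alternating n) ⟩
  0ℚ                                         ∎
  where
  T = binomialTransform
  cancel : ∀ t → t + - 1ℚ * t ≡ 0ℚ
  cancel = solve-∀ ring

recLHS : (ℕ → ℚ) → ℕ → ℚ
recLHS u n = (ℕ→ℚ 4 * ℕ→ℚ n * ℕ→ℚ n) * u n
           - (ℕ→ℚ 8 * ℕ→ℚ n * ℕ→ℚ n - ℕ→ℚ 8 * ℕ→ℚ n + ℕ→ℚ 3) * u (n ∸ 1)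
           + (ℕ→ℚ 4 * ℕ→ℚ (n ∸ 1) * ℕ→ℚ (n ∸ 1)) * u (n ∸ 2)

recLHS-θ : ∀ (u : ℕ → ℚ) n →
  recLHS u (suc n) ≡ ℕ→ℚ 4 * θ (θ u) (suc n) + ℕ→ℚ 4 * θ u n + u n
recLHS-θ u n rewrite ℕ→ℚ-suc n = polynomial (ℕ→ℚ n) (u (suc n)) (u n) (u (n ∸ 1))
  where
  polynomial : ∀ x u₁ u₀ u₋ →
    (ℕ→ℚ 4 * (1ℚ + x) * (1ℚ + x)) * u₁
    - (ℕ→ℚ 8 * (1ℚ + x) * (1ℚ + x) - ℕ→ℚ 8 * (1ℚ + x) + ℕ→ℚ 3) * u₀
    + (ℕ→ℚ 4 * x * x) * u₋
    ≡ ℕ→ℚ 4 * ((1ℚ + x) * ((1ℚ + x) * (u₁ - u₀) - x * (u₀ - u₋))) + ℕ→ℚ 4 * (x * (u₀ - u₋)) + u₀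
  polynomial = solve-∀ ring

dualRecLHS : (ℕ → ℚ) → ℕ → ℚ
dualRecLHS φ k = ℕ→ℚ 4 * ℕ→ℚ (suc k) * ℕ→ℚ (suc k) * φ (suc k)
               + ℕ→ℚ (suc (2 ℕ.* k)) * ℕ→ℚ (suc (2 ℕ.* k)) * φ k

binomialTransform-recLHS : ∀ (φ : ℕ → ℚ) n →
  recLHS (binomialTransform φ) (suc n) ≡ binomialTransform (dualRecLHS φ) n
binomialTransform-recLHS φ n = begin
  recLHS (T φ) (suc n)
    ≡⟨ recLHS-θ (T φ) n ⟩
  ℕ→ℚ 4 * θ (θ (T φ)) (suc n) + ℕ→ℚ 4 * θ (T φ) n + T φ n
    ≡⟨ cong (_+ T φ n) (ℚ.*-distribˡ-+ (ℕ→ℚ 4) (θ (θ (T φ)) (suc n)) (θ (T φ) n)) ⟨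
  ℕ→ℚ 4 * (θ (θ (T φ)) (suc n) + θ (T φ) n) + T φ n
    ≡⟨ cong (λ t → ℕ→ℚ 4 * t + T φ n) θ-terms ⟩
  ℕ→ℚ 4 * T ψ n + T φ n
    ≡⟨ cong (_+ T φ n) (binomialTransform-* (ℕ→ℚ 4) ψ n) ⟨
  T (λ k → ℕ→ℚ 4 * ψ k) n + T φ n
    ≡⟨ binomialTransform-+ (λ k → ℕ→ℚ 4 * ψ k) φ n ⟨
  T (λ k → ℕ→ℚ 4 * ψ k + φ k) n
    ≡⟨ binomialTransform-cong n expand ⟨
  T (dualRecLHS φ) n ∎
  where
  T = binomialTransform
  ψ₁ ψ₂ ψ : ℕ → ℚ
  ψ₁ k = ℕ→ℚ k * φ k
  ψ₂ k = ℕ→ℚ k * ψ₁ k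
  ψ k = ψ₂ k + ψ₂ (suc k) + ψ₁ k

  θ-terms : θ (θ (T φ)) (suc n) + θ (T φ) n ≡ T ψ n
  θ-terms = begin
    θ (θ (T φ)) (suc n) + θ (T φ) n
      ≡⟨ cong (_+ θ (T φ) n) (θ-cong (binomialTransform-θ φ) (suc n)) ⟨
    θ (T ψ₁) (suc n) + θ (T φ) n
      ≡⟨ cong₂ _+_ (binomialTransform-θ ψ₁ (suc n)) (binomialTransform-θ φ n) ⟨
    T ψ₂ (suc n) + T ψ₁ n
      ≡⟨ cong (_+ T ψ₁ n) (binomialTransform-suc ψ₂ n) ⟩
    T ψ₂ n + T (ψ₂ ∘ suc) n + T ψ₁ n
      ≡⟨ cong (_+ T ψ₁ n) (binomialTransform-+ ψ₂ (ψ₂ ∘ suc) n) ⟨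
    T (λ k → ψ₂ k + ψ₂ (suc k)) n + T ψ₁ n
      ≡⟨ binomialTransform-+ (λ k → ψ₂ k + ψ₂ (suc k)) ψ₁ n ⟨
    T ψ n ∎

  expand : ∀ k → dualRecLHS φ k ≡ ℕ→ℚ 4 * ψ k + φ k
  expand k rewrite ℕ→ℚ-odd k = polynomial (ℕ→ℚ k) (ℕ→ℚ (suc k)) (φ k) (φ (suc k))
    where
    polynomial : ∀ x z a b →
      ℕ→ℚ 4 * z * z * b + (ℕ→ℚ 2 * x + 1ℚ) * (ℕ→ℚ 2 * x + 1ℚ) * a
      ≡ ℕ→ℚ 4 * (x * (x * a) + z * (z * b) + x * a) + a
    polynomial = solve-∀ ring

recRHS-oddDF : ∀ n → ℕ→ℚ (oddDF n) * recRHS n ≡ ℕ→ℚ (2 ℕ.^ n ℕ.* (n ∸ 1) ℕ.!)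
recRHS-oddDF n = trans (ℚ.*-comm (ℕ→ℚ (oddDF n)) (recRHS n))
                       (/-*-cancel (2 ℕ.^ n ℕ.* (n ∸ 1) ℕ.!) (oddDF n) {{oddDF-nz n}})

recRHS-recurrence : ∀ n →
  ℕ→ℚ (suc (2 ℕ.* suc n)) * recRHS (2 ℕ.+ n) ≡ ℕ→ℚ (2 ℕ.* suc n) * recRHS (suc n)
recRHS-recurrence n = *-cancelˡ-≢0 (ℕ→ℚ-≢0 (oddDF (suc n)) {{oddDF-nz (suc n)}}) (begin
  D * (q * recRHS (2 ℕ.+ n))                   ≡⟨ ℚ.*-assoc D q (recRHS (2 ℕ.+ n)) ⟨
  (D * q) * recRHS (2 ℕ.+ n)                   ≡⟨ cong (_* recRHS (2 ℕ.+ n))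
                                                       (ℕ→ℚ-* (oddDF (suc n)) (suc (2 ℕ.* suc n))) ⟨
  ℕ→ℚ (oddDF (2 ℕ.+ n)) * recRHS (2 ℕ.+ n)     ≡⟨ recRHS-oddDF (2 ℕ.+ n) ⟩
  ℕ→ℚ (2 ℕ.^ (2 ℕ.+ n) ℕ.* (suc n) ℕ.!)        ≡⟨ cong ℕ→ℚ (regroup n (2 ℕ.^ suc n) (n ℕ.!)) ⟩
  ℕ→ℚ (2 ℕ.* suc n ℕ.* (2 ℕ.^ suc n ℕ.* n ℕ.!)) ≡⟨ ℕ→ℚ-* (2 ℕ.* suc n) (2 ℕ.^ suc n ℕ.* n ℕ.!) ⟩
  m * ℕ→ℚ (2 ℕ.^ suc n ℕ.* n ℕ.!)              ≡⟨ cong (m *_) (recRHS-oddDF (suc n)) ⟨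
  m * (D * recRHS (suc n))                     ≡⟨ swap m D (recRHS (suc n)) ⟩
  D * (m * recRHS (suc n))                     ∎)
  where
  D = ℕ→ℚ (oddDF (suc n))
  q = ℕ→ℚ (suc (2 ℕ.* suc n))
  m = ℕ→ℚ (2 ℕ.* suc n)
  regroup : ∀ n p f → 2 ℕ.* p ℕ.* (suc n ℕ.* f) ≡ 2 ℕ.* suc n ℕ.* (p ℕ.* f)
  regroup = ℕ-solve-∀
  swap : ∀ a b c → a * (b * c) ≡ b * (a * c)
  swap = solve-∀ ring

module _ (g : ℕ → ℚ) (odd-*-g : ∀ k → ℕ→ℚ (suc (2 ℕ.* k)) * g k ≡ ℕ→ℚ 2 * alternating k) where

  private
    T = binomialTransform g

    odd-expansion : ∀ k → ℕ→ℚ 2 * (ℕ→ℚ k * g k) + g k ≡ ℕ→ℚ 2 * alternating k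
    odd-expansion k = begin
      ℕ→ℚ 2 * (ℕ→ℚ k * g k) + g k   ≡⟨ distrib (ℕ→ℚ k) (g k) ⟩
      (ℕ→ℚ 2 * ℕ→ℚ k + 1ℚ) * g k    ≡⟨ cong (_* g k) (ℕ→ℚ-odd k) ⟨
      ℕ→ℚ (suc (2 ℕ.* k)) * g k     ≡⟨ odd-*-g k ⟩
      ℕ→ℚ 2 * alternating k         ∎
      where
      distrib : ∀ x a → ℕ→ℚ 2 * (x * a) + a ≡ (ℕ→ℚ 2 * x + 1ℚ) * a
      distrib = solve-∀ ring

    2θ+id-vanishes : ∀ n → ℕ→ℚ 2 * θ T (suc n) + T (suc n) ≡ 0ℚ
    2θ+id-vanishes n = begin
      ℕ→ℚ 2 * θ T m + T m
        ≡⟨ cong (λ t → ℕ→ℚ 2 * t + T m) (binomialTransform-θ g m) ⟨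
      ℕ→ℚ 2 * BT (λ k → ℕ→ℚ k * g k) m + T m
        ≡⟨ cong (_+ T m) (binomialTransform-* (ℕ→ℚ 2) (λ k → ℕ→ℚ k * g k) m) ⟨
      BT (λ k → ℕ→ℚ 2 * (ℕ→ℚ k * g k)) m + T m
        ≡⟨ binomialTransform-+ (λ k → ℕ→ℚ 2 * (ℕ→ℚ k * g k)) g m ⟨
      BT (λ k → ℕ→ℚ 2 * (ℕ→ℚ k * g k) + g k) m
        ≡⟨ binomialTransform-cong m odd-expansion ⟩
      BT (λ k → ℕ→ℚ 2 * alternating k) m
        ≡⟨ binomialTransform-* (ℕ→ℚ 2) alternating m ⟩
      ℕ→ℚ 2 * BT alternating m
        ≡⟨ cong (ℕ→ℚ 2 *_) (binomialTransform-alternating n) ⟩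
      ℕ→ℚ 2 * 0ℚ
        ≡⟨ ℚ.*-zeroʳ (ℕ→ℚ 2) ⟩
      0ℚ ∎
      where
      m = suc n
      BT = binomialTransform

    first-order-recurrence : ∀ n → ℕ→ℚ (suc (2 ℕ.* suc n)) * T (suc n) ≡ ℕ→ℚ (2 ℕ.* suc n) * T n
    first-order-recurrence n = begin
      ℕ→ℚ (suc (2 ℕ.* m)) * T m                  ≡⟨ cong (_* T m) (ℕ→ℚ-odd m) ⟩
      (ℕ→ℚ 2 * x + 1ℚ) * T m                     ≡⟨ rearrange x (T m) (T n) ⟩
      ℕ→ℚ 2 * x * T n + (ℕ→ℚ 2 * θ T m + T m)    ≡⟨ cong (_+_ (ℕ→ℚ 2 * x * T n))
                                                         (2θ+id-vanishes n) ⟩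
      ℕ→ℚ 2 * x * T n + 0ℚ                       ≡⟨ ℚ.+-identityʳ (ℕ→ℚ 2 * x * T n) ⟩
      ℕ→ℚ 2 * x * T n                            ≡⟨ cong (_* T n) (ℕ→ℚ-* 2 m) ⟨
      ℕ→ℚ (2 ℕ.* m) * T n                        ∎
      where
      m = suc n
      x = ℕ→ℚ m
      rearrange : ∀ x a b → (ℕ→ℚ 2 * x + 1ℚ) * a ≡ ℕ→ℚ 2 * x * b + (ℕ→ℚ 2 * (x * (a - b)) + a)
      rearrange = solve-∀ ring

  binomialTransform≡recRHS : ∀ n → binomialTransform g n ≡ recRHS (suc n)
  binomialTransform≡recRHS zero    = trans (ℚ.+-identityˡ (1ℚ * g 0)) (odd-*-g 0)
  binomialTransform≡recRHS (suc n) = *-cancelˡ-≢0 (ℕ→ℚ-≢0 (suc (2 ℕ.* suc n))) (begin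
    ℕ→ℚ (suc (2 ℕ.* suc n)) * T (suc n)            ≡⟨ first-order-recurrence n ⟩
    ℕ→ℚ (2 ℕ.* suc n) * T n                        ≡⟨ cong (ℕ→ℚ (2 ℕ.* suc n) *_)
                                                           (binomialTransform≡recRHS n) ⟩
    ℕ→ℚ (2 ℕ.* suc n) * recRHS (suc n)             ≡⟨ recRHS-recurrence n ⟨
    ℕ→ℚ (suc (2 ℕ.* suc n)) * recRHS (2 ℕ.+ n)     ∎)

recLHS-leading-≢0 : ∀ n → ℕ→ℚ 4 * ℕ→ℚ (suc n) * ℕ→ℚ (suc n) ≢ 0ℚ
recLHS-leading-≢0 n = *-≢0 (*-≢0 (ℕ→ℚ-≢0 4) (ℕ→ℚ-≢0 (suc n))) (ℕ→ℚ-≢0 (suc n))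

recLHS-injective : ∀ {u v : ℕ → ℚ} → u 0 ≡ v 0 → u 1 ≡ v 1 →
  (∀ n → recLHS u (2 ℕ.+ n) ≡ recLHS v (2 ℕ.+ n)) → ∀ n → u n ≡ v n
recLHS-injective {u} {v} u₀≡v₀ u₁≡v₁ L≡L n = proj₁ (agree n)
  where
  agree : ∀ n → u n ≡ v n × u (suc n) ≡ v (suc n)
  agree zero    = u₀≡v₀ , u₁≡v₁
  agree (suc n) with uₙ≡vₙ , uₙ₊₁≡vₙ₊₁ ← agree n = uₙ₊₁≡vₙ₊₁ ,
    *-cancelˡ-≢0 (recLHS-leading-≢0 (suc n))
      (∙-cancelʳ _ _ _ (∙-cancelʳ _ _ _ (begin
        A * u (2 ℕ.+ n) - B * u (suc n) + C * u n ≡⟨ L≡L n ⟩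
        A * v (2 ℕ.+ n) - B * v (suc n) + C * v n ≡⟨ cong₂ (λ a b → A * v (2 ℕ.+ n) - B * a + C * b)
                                                            uₙ₊₁≡vₙ₊₁ uₙ≡vₙ ⟨
        A * v (2 ℕ.+ n) - B * u (suc n) + C * u n ∎)))
    where
    A = ℕ→ℚ 4 * ℕ→ℚ (2 ℕ.+ n) * ℕ→ℚ (2 ℕ.+ n)
    B = ℕ→ℚ 8 * ℕ→ℚ (2 ℕ.+ n) * ℕ→ℚ (2 ℕ.+ n) - ℕ→ℚ 8 * ℕ→ℚ (2 ℕ.+ n) + ℕ→ℚ 3
    C = ℕ→ℚ 4 * ℕ→ℚ (suc n) * ℕ→ℚ (suc n)

gbinom-suc : ∀ a k → ℕ→ℚ (suc k) * gbinom a (suc k) ≡ (a - ℕ→ℚ k) * gbinom a k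
gbinom-suc a k = begin
  ℕ→ℚ (suc k) * (gbinom a k * ((a - ℕ→ℚ k) * (+ 1 / suc k)))
    ≡⟨ regroup (ℕ→ℚ (suc k)) (gbinom a k) (a - ℕ→ℚ k) (+ 1 / suc k) ⟩
  ((a - ℕ→ℚ k) * gbinom a k) * ((+ 1 / suc k) * ℕ→ℚ (suc k))
    ≡⟨ cong ((a - ℕ→ℚ k) * gbinom a k *_) (/-*-cancel 1 (suc k)) ⟩
  ((a - ℕ→ℚ k) * gbinom a k) * 1ℚ
    ≡⟨ ℚ.*-identityʳ ((a - ℕ→ℚ k) * gbinom a k) ⟩
  (a - ℕ→ℚ k) * gbinom a k ∎
  where
  regroup : ∀ K g d i → K * (g * (d * i)) ≡ (d * g) * (i * K)
  regroup = solve-∀ ring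

bh-suc : ∀ k → ℕ→ℚ 2 * ℕ→ℚ (suc k) * bh (suc k) ≡ - (ℕ→ℚ (suc (2 ℕ.* k)) * bh k)
bh-suc k = begin
  ℕ→ℚ 2 * ℕ→ℚ (suc k) * bh (suc k)         ≡⟨ ℚ.*-assoc (ℕ→ℚ 2) (ℕ→ℚ (suc k)) (bh (suc k)) ⟩
  ℕ→ℚ 2 * (ℕ→ℚ (suc k) * bh (suc k))       ≡⟨ cong (ℕ→ℚ 2 *_) (gbinom-suc (- (+ 1 / 2)) k) ⟩
  ℕ→ℚ 2 * ((- (+ 1 / 2) - ℕ→ℚ k) * bh k)   ≡⟨ halve (ℕ→ℚ k) (bh k) ⟩
  - ((ℕ→ℚ 2 * ℕ→ℚ k + 1ℚ) * bh k)          ≡⟨ cong (λ q → - (q * bh k)) (ℕ→ℚ-odd k) ⟨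
  - (ℕ→ℚ (suc (2 ℕ.* k)) * bh k)           ∎
  where
  halve : ∀ x b → ℕ→ℚ 2 * ((- (+ 1 / 2) - x) * b) ≡ - ((ℕ→ℚ 2 * x + 1ℚ) * b)
  halve = solve-∀ ring

bh-≢0 : ∀ k → bh k ≢ 0ℚ
bh-≢0 zero    ()
bh-≢0 (suc k) b′≡0 = *-≢0 (ℕ→ℚ-≢0 (suc (2 ℕ.* k))) (bh-≢0 k) (ℚ.neg-injective (begin
  - (ℕ→ℚ (suc (2 ℕ.* k)) * bh k)           ≡⟨ bh-suc k ⟨
  ℕ→ℚ 2 * ℕ→ℚ (suc k) * bh (suc k)         ≡⟨ cong (ℕ→ℚ 2 * ℕ→ℚ (suc k) *_) b′≡0 ⟩
  ℕ→ℚ 2 * ℕ→ℚ (suc k) * 0ℚ                 ≡⟨ ℚ.*-zeroʳ (ℕ→ℚ 2 * ℕ→ℚ (suc k)) ⟩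
  - 0ℚ                                     ∎))

innerSum : ℕ → ℚ
innerSum k = Σ< k (λ j → inv (ℕ→ℚ (suc (2 ℕ.* j)) ^ℚ 3) * inv (bh j ^ℚ 2))

φ : ℕ → ℚ
φ k = - ℕ→ℚ 2 * (alternating k * (bh k ^ℚ 2 * innerSum k))

odd-*-dualRecLHS-φ : ∀ k → ℕ→ℚ (suc (2 ℕ.* k)) * dualRecLHS φ k ≡ ℕ→ℚ 2 * alternating k
odd-*-dualRecLHS-φ k = begin
  q * dualRecLHS φ k
    ≡⟨ expand q (ℕ→ℚ (suc k)) b′ b s S h ⟩
  ℕ→ℚ 2 * s * (q * (ℕ→ℚ 2 * ℕ→ℚ (suc k) * b′) ^ℚ 2 * (S + h) - q * (q * b) ^ℚ 2 * S)
    ≡⟨ cong (λ t → ℕ→ℚ 2 * s * (q * t ^ℚ 2 * (S + h) - q * (q * b) ^ℚ 2 * S)) (bh-suc k) ⟩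
  ℕ→ℚ 2 * s * (q * (- (q * b)) ^ℚ 2 * (S + h) - q * (q * b) ^ℚ 2 * S)
    ≡⟨ collect q b s S h ⟩
  ℕ→ℚ 2 * s * ((q ^ℚ 3 * b ^ℚ 2) * h)
    ≡⟨ cong (ℕ→ℚ 2 * s *_) (*-inv-cancel (^ℚ-≢0 3 (ℕ→ℚ-≢0 (suc (2 ℕ.* k)))) (^ℚ-≢0 2 (bh-≢0 k))) ⟩
  ℕ→ℚ 2 * s * 1ℚ
    ≡⟨ ℚ.*-identityʳ (ℕ→ℚ 2 * s) ⟩
  ℕ→ℚ 2 * s ∎
  where
  q = ℕ→ℚ (suc (2 ℕ.* k))
  s = alternating k
  b = bh k
  b′ = bh (suc k)
  S = innerSum k
  h = inv (q ^ℚ 3) * inv (b ^ℚ 2)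
  expand : ∀ q K b′ b s S h →
    q * (ℕ→ℚ 4 * K * K * (- ℕ→ℚ 2 * ((- 1ℚ * s) * (b′ * (b′ * 1ℚ) * (S + h))))
         + q * q * (- ℕ→ℚ 2 * (s * (b * (b * 1ℚ) * S))))
    ≡ ℕ→ℚ 2 * s * (q * ((ℕ→ℚ 2 * K * b′) * ((ℕ→ℚ 2 * K * b′) * 1ℚ)) * (S + h)
                   - q * ((q * b) * ((q * b) * 1ℚ)) * S)
  expand = solve-∀ ring
  collect : ∀ q b s S h →
    ℕ→ℚ 2 * s * (q * ((- (q * b)) * ((- (q * b)) * 1ℚ)) * (S + h)
                   - q * ((q * b) * ((q * b) * 1ℚ)) * S)
    ≡ ℕ→ℚ 2 * s * ((q * (q * (q * 1ℚ)) * (b * (b * 1ℚ))) * h)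
  collect = solve-∀ ring

binomialTransform-φ-recurrence : ∀ n → recLHS (binomialTransform φ) (suc n) ≡ recRHS (suc n)
binomialTransform-φ-recurrence n = trans (binomialTransform-recLHS φ n)
  (binomialTransform≡recRHS (dualRecLHS φ) odd-*-dualRecLHS-φ n)

⊛-congʳ : ∀ (f : Series) {Q R : Series} → (∀ m → Q m ≡ R m) → ∀ n → (f ⊛ Q) n ≡ (f ⊛ R) n
⊛-congʳ f Q≡R n = Σ<-cong (suc n) (λ i → cong (f i *_) (Q≡R (n ∸ i)))

⊛-distribˡ-+ : ∀ (f Q R : Series) n → (f ⊛ (λ m → Q m + R m)) n ≡ (f ⊛ Q) n + (f ⊛ R) n
⊛-distribˡ-+ f Q R n = trans
  (Σ<-cong (suc n) (λ i → ℚ.*-distribˡ-+ (f i) (Q (n ∸ i)) (R (n ∸ i))))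
  (Σ<-distrib-+ (suc n) (λ i → f i * Q (n ∸ i)) (λ i → f i * R (n ∸ i)))

⊛-zero : ∀ (f Q : Series) → (f ⊛ Q) 0 ≡ f 0 * Q 0
⊛-zero f Q = ℚ.+-identityˡ (f 0 * Q 0)

⊛-identityʳ : ∀ (f S : Series) n → (f ⊛ (S ^S 0)) n ≡ f n
⊛-identityʳ f S n = begin
  Σ< n (λ i → f i * (S ^S 0) (n ∸ i)) + f n * (S ^S 0) (n ∸ n)
    ≡⟨ cong₂ _+_ (Σ<-vanish n (λ i i<n → trans (cong (f i *_) (unit-positive (ℕ.m<n⇒0<n∸m i<n)))
                                                 (ℚ.*-zeroʳ (f i))))
                 (cong (λ t → f n * (S ^S 0) t) (ℕ.n∸n≡0 n)) ⟩
  0ℚ + f n * 1ℚ                     ≡⟨ ℚ.+-identityˡ (f n * 1ℚ) ⟩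
  f n * 1ℚ                          ≡⟨ ℚ.*-identityʳ (f n) ⟩
  f n                               ∎
  where
  unit-positive : ∀ {t} → 0 < t → (S ^S 0) t ≡ 0ℚ
  unit-positive {suc t} _ = refl

⊛-shiftʳ : ∀ (f Q : Series) n → Q 0 ≡ 0ℚ → (f ⊛ Q) (suc n) ≡ (f ⊛ (Q ∘ suc)) n
⊛-shiftʳ f Q n Q₀≡0 = begin
  Σ< (suc n) (λ i → f i * Q (suc n ∸ i)) + f (suc n) * Q (n ∸ n)
    ≡⟨ cong₂ _+_ (Σ<-cong-< (suc n) (λ i i<1+n →
                    cong (λ t → f i * Q t) (ℕ.+-∸-assoc 1 (ℕ.≤-pred i<1+n))))
                 (trans (cong (λ t → f (suc n) * Q t) (ℕ.n∸n≡0 n))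
                        (trans (cong (f (suc n) *_) Q₀≡0) (ℚ.*-zeroʳ (f (suc n))))) ⟩
  (f ⊛ (Q ∘ suc)) n + 0ℚ            ≡⟨ ℚ.+-identityʳ ((f ⊛ (Q ∘ suc)) n) ⟩
  (f ⊛ (Q ∘ suc)) n                 ∎

alternating-⊛-suc : ∀ (Q : Series) m → (alternating ⊛ Q) (suc m) + (alternating ⊛ Q) m ≡ Q (suc m)
alternating-⊛-suc Q m = begin
  (alternating ⊛ Q) (suc m) + A
    ≡⟨ cong (_+ A) (Σ<-sucˡ (suc m) (λ i → alternating i * Q (suc m ∸ i))) ⟩
  (1ℚ * Q (suc m) + Σ< (suc m) (λ i → (- 1ℚ * alternating i) * Q (m ∸ i))) + A
    ≡⟨ cong (λ t → (1ℚ * Q (suc m) + t) + A) (begin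
         Σ< (suc m) (λ i → (- 1ℚ * alternating i) * Q (m ∸ i))
           ≡⟨ Σ<-cong (suc m) (λ i → ℚ.*-assoc (- 1ℚ) (alternating i) (Q (m ∸ i))) ⟩
         Σ< (suc m) (λ i → - 1ℚ * (alternating i * Q (m ∸ i)))
           ≡⟨ *-distribˡ-Σ< (suc m) (- 1ℚ) (λ i → alternating i * Q (m ∸ i)) ⟨
         - 1ℚ * A ∎) ⟩
  (1ℚ * Q (suc m) + - 1ℚ * A) + A
    ≡⟨ cancel (Q (suc m)) A ⟩
  Q (suc m) ∎
  where
  A = (alternating ⊛ Q) m
  cancel : ∀ q a → (1ℚ * q + - 1ℚ * a) + a ≡ q
  cancel = solve-∀ ring

xOver1px-⊛-suc : ∀ (Q : Series) m → (xOver1px ⊛ Q) (suc m) ≡ (alternating ⊛ Q) m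
xOver1px-⊛-suc Q m = trans (Σ<-sucˡ (suc m) (λ i → xOver1px i * Q (suc m ∸ i)))
                           (drop-zero (Q (suc m)) ((alternating ⊛ Q) m))
  where
  drop-zero : ∀ a b → 0ℚ * a + b ≡ b
  drop-zero = solve-∀ ring

xOver1px-⊛-recurrence : ∀ (Q : Series) m → (xOver1px ⊛ Q) (suc m) + (xOver1px ⊛ Q) m ≡ Q m
xOver1px-⊛-recurrence Q zero = begin
  (xOver1px ⊛ Q) 1 + (xOver1px ⊛ Q) 0   ≡⟨ cong₂ _+_ (xOver1px-⊛-suc Q 0) (⊛-zero xOver1px Q) ⟩
  (0ℚ + 1ℚ * Q 0) + 0ℚ * Q 0            ≡⟨ simplify (Q 0) ⟩
  Q 0                                   ∎
  where
  simplify : ∀ a → (0ℚ + 1ℚ * a) + 0ℚ * a ≡ a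
  simplify = solve-∀ ring
xOver1px-⊛-recurrence Q (suc m) =
  trans (cong₂ _+_ (xOver1px-⊛-suc Q (suc m)) (xOver1px-⊛-suc Q m)) (alternating-⊛-suc Q m)

xOver1px^-vanish : ∀ {m k} → m < k → (xOver1px ^S k) m ≡ 0ℚ
xOver1px^-vanish {zero}  {suc k} _         =
  trans (⊛-zero xOver1px (xOver1px ^S k)) (ℚ.*-zeroˡ ((xOver1px ^S k) 0))
xOver1px^-vanish {suc m} {suc k} (s≤s m<k) = begin
  P (suc k) (suc m)                       ≡⟨ x+y≡z⇒x≡z-y (xOver1px-⊛-recurrence (P k) m) ⟩
  P k m - P (suc k) m                     ≡⟨ cong₂ _-_ (xOver1px^-vanish m<k)
                                                       (xOver1px^-vanish (ℕ.m<n⇒m<1+n m<k)) ⟩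
  0ℚ - 0ℚ                                 ≡⟨⟩
  0ℚ                                      ∎
  where
  P = xOver1px ^S_

binomialTimesPower : ℚ → ℕ → Series
binomialTimesPower a k = gbinom a ⊛ (xOver1px ^S k)

binomialTimesPower-recurrence : ∀ a k n →
  binomialTimesPower a (suc k) (suc n) ≡ binomialTimesPower a k n - binomialTimesPower a (suc k) n
binomialTimesPower-recurrence a k n = x+y≡z⇒x≡z-y (begin
  (gbinom a ⊛ P (suc k)) (suc n) + (gbinom a ⊛ P (suc k)) n
    ≡⟨ cong (_+ (gbinom a ⊛ P (suc k)) n)
            (⊛-shiftʳ (gbinom a) (P (suc k)) n (xOver1px^-vanish {k = suc k} (s≤s z≤n))) ⟩
  (gbinom a ⊛ (P (suc k) ∘ suc)) n + (gbinom a ⊛ P (suc k)) n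
    ≡⟨ ⊛-distribˡ-+ (gbinom a) (P (suc k) ∘ suc) (P (suc k)) n ⟨
  (gbinom a ⊛ (λ m → P (suc k) (suc m) + P (suc k) m)) n
    ≡⟨ ⊛-congʳ (gbinom a) (xOver1px-⊛-recurrence (P k)) n ⟩
  (gbinom a ⊛ P k) n ∎)
  where
  P = xOver1px ^S_

gbinom-*-binomialTimesPower : ∀ a k n →
  gbinom a k * binomialTimesPower a k n ≡ gbinom a n * binom n k
gbinom-*-binomialTimesPower a zero n = begin
  1ℚ * binomialTimesPower a 0 n    ≡⟨ ℚ.*-identityˡ _ ⟩
  binomialTimesPower a 0 n         ≡⟨ ⊛-identityʳ (gbinom a) xOver1px n ⟩
  gbinom a n                       ≡⟨ ℚ.*-identityʳ (gbinom a n) ⟨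
  gbinom a n * 1ℚ                  ∎
gbinom-*-binomialTimesPower a (suc k) zero = begin
  gbinom a (suc k) * binomialTimesPower a (suc k) 0
    ≡⟨ cong (gbinom a (suc k) *_) (trans (⊛-zero (gbinom a) (xOver1px ^S suc k))
         (cong (gbinom a 0 *_) (xOver1px^-vanish {k = suc k} (s≤s z≤n)))) ⟩
  gbinom a (suc k) * (1ℚ * 0ℚ)     ≡⟨ ℚ.*-zeroʳ (gbinom a (suc k)) ⟩
  0ℚ                               ≡⟨ ℚ.*-zeroʳ (gbinom a 0) ⟨
  gbinom a 0 * 0ℚ                  ∎
gbinom-*-binomialTimesPower a (suc k) (suc n) =
  *-cancelˡ-≢0 (*-≢0 (ℕ→ℚ-≢0 (suc k)) (ℕ→ℚ-≢0 (suc n))) (begin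
  (K * N) * (c (suc k) * G (suc k) (suc n))
    ≡⟨ cong (λ t → (K * N) * (c (suc k) * t)) (binomialTimesPower-recurrence a k n) ⟩
  (K * N) * (c (suc k) * (G k n - G (suc k) n))
    ≡⟨ expand K N (c (suc k)) (G k n) (G (suc k) n) ⟩
  N * (K * c (suc k)) * G k n - N * K * (c (suc k) * G (suc k) n)
    ≡⟨ cong₂ (λ s t → N * s * G k n - N * K * t) (gbinom-suc a k)
             (gbinom-*-binomialTimesPower a (suc k) n) ⟩
  N * ((a - y) * c k) * G k n - N * K * (c n * binom n (suc k))
    ≡⟨ regroup N K (a - y) (c k) (G k n) (c n) (binom n (suc k)) ⟩
  N * (a - y) * (c k * G k n) - N * c n * (K * binom n (suc k))
    ≡⟨ cong₂ (λ s t → N * (a - y) * s - N * c n * t)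
             (gbinom-*-binomialTimesPower a k n) (binom-sucʳ n k) ⟩
  N * (a - y) * (c n * binom n k) - N * c n * ((x - y) * binom n k)
    ≡⟨ collect N a x y (c n) (binom n k) ⟩
  (a - x) * c n * (N * binom n k)
    ≡⟨ cong ((a - x) * c n *_) (binom-absorption n k) ⟨
  (a - x) * c n * (K * binom (suc n) (suc k))
    ≡⟨ cong (λ t → t * (K * binom (suc n) (suc k))) (gbinom-suc a n) ⟨
  N * c (suc n) * (K * binom (suc n) (suc k))
    ≡⟨ reorder N K (c (suc n)) (binom (suc n) (suc k)) ⟩
  (K * N) * (c (suc n) * binom (suc n) (suc k)) ∎)
  where
  c = gbinom a
  G = binomialTimesPower a
  K = ℕ→ℚ (suc k)
  N = ℕ→ℚ (suc n)
  x = ℕ→ℚ n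
  y = ℕ→ℚ k
  expand : ∀ K N c′ g g′ → (K * N) * (c′ * (g - g′)) ≡ N * (K * c′) * g - N * K * (c′ * g′)
  expand = solve-∀ ring
  regroup : ∀ N K d c g e B → N * (d * c) * g - N * K * (e * B) ≡ N * d * (c * g) - N * e * (K * B)
  regroup = solve-∀ ring
  collect : ∀ N a x y e B → N * (a - y) * (e * B) - N * e * ((x - y) * B) ≡ (a - x) * e * (N * B)
  collect = solve-∀ ring
  reorder : ∀ N K e B → N * e * (K * B) ≡ (K * N) * (e * B)
  reorder = solve-∀ ring

⊛-compose≥1-xOver1px : ∀ (f : Series) (c : ℕ → ℚ) n →
  (f ⊛ compose≥1 c xOver1px) n ≡ Σ< n (λ i → c (suc i) * (f ⊛ (xOver1px ^S suc i)) n)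
⊛-compose≥1-xOver1px f c n = begin
  Σ< (suc n) (λ l → f l * Σ< (n ∸ l) (λ i → c (suc i) * P (suc i) (n ∸ l)))
    ≡⟨ Σ<-cong (suc n) (λ l → cong (f l *_) (sym (Σ<-extend n (ℕ.m∸n≤m n l)
         (λ i n∸l≤i → trans (cong (c (suc i) *_) (xOver1px^-vanish (s≤s n∸l≤i)))
                            (ℚ.*-zeroʳ (c (suc i))))))) ⟩
  Σ< (suc n) (λ l → f l * Σ< n (λ i → c (suc i) * P (suc i) (n ∸ l)))
    ≡⟨ Σ<-cong (suc n) (λ l → *-distribˡ-Σ< n (f l) (λ i → c (suc i) * P (suc i) (n ∸ l))) ⟩
  Σ< (suc n) (λ l → Σ< n (λ i → f l * (c (suc i) * P (suc i) (n ∸ l))))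
    ≡⟨ Σ<-comm (suc n) n (λ l i → f l * (c (suc i) * P (suc i) (n ∸ l))) ⟩
  Σ< n (λ i → Σ< (suc n) (λ l → f l * (c (suc i) * P (suc i) (n ∸ l))))
    ≡⟨ Σ<-cong n (λ i → trans
         (Σ<-cong (suc n) (λ l → swap (f l) (c (suc i)) (P (suc i) (n ∸ l))))
         (sym (*-distribˡ-Σ< (suc n) (c (suc i)) (λ l → f l * P (suc i) (n ∸ l))))) ⟩
  Σ< n (λ i → c (suc i) * (f ⊛ P (suc i)) n) ∎
  where
  P = xOver1px ^S_
  swap : ∀ a b c → a * (b * c) ≡ b * (a * c)
  swap = solve-∀ ring

cCoeff≡bh*φ : ∀ k → - ℕ→ℚ 2 * cCoeff k ≡ bh k * φ k
cCoeff≡bh*φ k = regroup (alternating k) (bh k) (innerSum k)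
  where
  regroup : ∀ s b S →
    - ℕ→ℚ 2 * (s * (b * (b * (b * 1ℚ))) * S) ≡ b * (- ℕ→ℚ 2 * (s * (b * (b * 1ℚ) * S)))
  regroup = solve-∀ ring

rhsSeries≡bh*binomialTransform-φ : ∀ n → rhsSeries n ≡ bh n * binomialTransform φ n
rhsSeries≡bh*binomialTransform-φ n = begin
  - ℕ→ℚ 2 * (bh ⊛ compose≥1 cCoeff xOver1px) n
    ≡⟨ cong (- ℕ→ℚ 2 *_) (⊛-compose≥1-xOver1px bh cCoeff n) ⟩
  - ℕ→ℚ 2 * Σ< n (λ i → cCoeff (suc i) * G (suc i) n)
    ≡⟨ *-distribˡ-Σ< n (- ℕ→ℚ 2) (λ i → cCoeff (suc i) * G (suc i) n) ⟩
  Σ< n (λ i → - ℕ→ℚ 2 * (cCoeff (suc i) * G (suc i) n))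
    ≡⟨ Σ<-cong n (λ i → term (suc i)) ⟩
  Σ< n (λ i → bh n * (binom n (suc i) * φ (suc i)))
    ≡⟨ *-distribˡ-Σ< n (bh n) (λ i → binom n (suc i) * φ (suc i)) ⟨
  bh n * Σ< n (λ i → binom n (suc i) * φ (suc i))
    ≡⟨ cong (bh n *_) (sym (trans (Σ<-sucˡ n (λ k → binom n k * φ k))
                                  (ℚ.+-identityˡ (Σ< n (λ i → binom n (suc i) * φ (suc i)))))) ⟩
  bh n * binomialTransform φ n ∎
  where
  G = binomialTimesPower (- (+ 1 / 2))
  term : ∀ k → - ℕ→ℚ 2 * (cCoeff k * G k n) ≡ bh n * (binom n k * φ k)
  term k = begin
    - ℕ→ℚ 2 * (cCoeff k * G k n)    ≡⟨ ℚ.*-assoc (- ℕ→ℚ 2) (cCoeff k) (G k n) ⟨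
    (- ℕ→ℚ 2 * cCoeff k) * G k n    ≡⟨ cong (_* G k n) (cCoeff≡bh*φ k) ⟩
    (bh k * φ k) * G k n            ≡⟨ swap (bh k) (φ k) (G k n) ⟩
    φ k * (bh k * G k n)            ≡⟨ cong (φ k *_)
                                             (gbinom-*-binomialTimesPower (- (+ 1 / 2)) k n) ⟩
    φ k * (bh n * binom n k)        ≡⟨ swap′ (φ k) (bh n) (binom n k) ⟩
    bh n * (binom n k * φ k)        ∎
    where
    swap : ∀ b f g → (b * f) * g ≡ f * (b * g)
    swap = solve-∀ ring
    swap′ : ∀ f b c → f * (b * c) ≡ b * (c * f)
    swap′ = solve-∀ ring

corollary4p4 : (J : ℕ → ℚ) → J 0 ≡ 0ℚ → J 1 ≡ + 1 / 2
    → (∀ n → n ≥ 2 →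
         (ℕ→ℚ 4 * ℕ→ℚ n * ℕ→ℚ n) * J n
         - (ℕ→ℚ 8 * ℕ→ℚ n * ℕ→ℚ n - ℕ→ℚ 8 * ℕ→ℚ n + ℕ→ℚ 3) * J (n ∸ 1)
         + (ℕ→ℚ 4 * ℕ→ℚ (n ∸ 1) * ℕ→ℚ (n ∸ 1)) * J (n ∸ 2)
         ≡ recRHS n)
    → ∀ n → g̃₃ J n ≡ rhsSeries n
corollary4p4 J J₀ J₁ recurrence n = begin
  g̃₃ J n                          ≡⟨ cong (bh n *_) (J≡binomialTransform-φ n) ⟩
  bh n * binomialTransform φ n    ≡⟨ rhsSeries≡bh*binomialTransform-φ n ⟨
  rhsSeries n                     ∎
  where
  J≡binomialTransform-φ : ∀ n → J n ≡ binomialTransform φ n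
  J≡binomialTransform-φ = recLHS-injective J₀ J₁ (λ n →
    trans (recurrence (2 ℕ.+ n) (s≤s (s≤s z≤n))) (sym (binomialTransform-φ-recurrence (suc n))))
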